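{- Let $G=(V,E)$ be a finite graph with $n=|V|$ nodes that has a perfect matching. For all $t\in[n]$, $1-x_t=\sum_{i=1}^t\alpha_i$; consequently, for all $t\in\{2,\dots,n\}$, $x_{t-1}-x_t=\alpha_t$.
   Context: Ranking: given a bijection $\sigma:V\to[n]$ (permutation; $\sigma(u)$ is the rank of $u$), list all unordered pairs of distinct nodes lexicographically by $\sigma$ (write each pair $\{a,b\}$ with $\sigma(a)<\sigma(b)$; $\{a_1,b_1\}$ precedes $\{a_2,b_2\}$ iff $\sigma(a_1)<\sigma(a_2)$, or $a_1=a_2$ and $\sigma(b_1)<\sigma(b_2)$), and probe them in this order: when $\{a,b\}$ is probed, if both are unmatched and $\{a,b\}\in E$, match them to each other. $M(\sigma)$ is the resulting matching; "$u$ is matched in $\sigma$" means $u$ is covered by $M(\sigma)$. Let $\Omega$ be the set of all $n!$ permutations. For $\sigma\in\Omega$ and $u\in V$, $\sigma_u^i$ denotes the permutation obtained by removing $u$ from $\sigma$ (keeping the relative order of the other nodes) and reinserting $u$ at rank $i$. For $t\in[n]$: $Q_t=\{(\sigma,u):\sigma\in\Omega,\ u=\sigma^{ -1}(t)\text{ is matched in }\sigma\}$, $R_t=\{(\sigma,u):\sigma\in\Omega,\ u=\sigma^{ -1}(t)\text{ is unmatched in }\sigma\}$; $S_1=\emptyset$ and for $t\in\{2,\dots,n\}$, $S_t=\{(\sigma,u)\in R_t:(\sigma_u^{t-1},u)\notin R_{t-1}\}$. Define $x_t=|Q_t|/n!$ and $\alpha_t=|S_t|/n!$. -}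

module Defs where

open import Data.Bool using (Bool; true; false; not; _∧_; _∨_; if_then_else_)
open import Data.Nat using (ℕ; zero; suc; _+_; _∸_; _≡ᵇ_)
open import Data.Fin using (Fin)
open import Data.Fin.Properties using () renaming (_≟_ to _≟ᶠ_)
open import Data.List using (List; []; _∷_; length; map; concatMap; allFin; filterᵇ; upTo)
open import Data.Maybe using (Maybe; just; nothing)
open import Relation.Nullary using (¬_; does)
open import Relation.Binary.PropositionalEquality using (_≡_; _≢_)

record Graph (n : ℕ) : Set where
  field
    adj   : Fin n → Fin n → Bool
    sym   : ∀ u v → adj u v ≡ adj v u
    irref : ∀ u → adj u u ≡ false
open Graph public

-- G has a perfect matching: a fixed-point-free involution pairing each
-- node with a neighbour.
HasPerfectMatching : ∀ {n} → Graph n → Set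
HasPerfectMatching {n} G =
  Data.Product.Σ (Fin n → Fin n) λ m →
    (∀ u → adj G u (m u) ≡ true) Data.Product.× (∀ u → m (m u) ≡ u)
  where import Data.Product

-- Permutations.  A bijection σ : V → [n] is represented by the list of
-- nodes in increasing rank order, i.e. [σ⁻¹(1), …, σ⁻¹(n)].

allLists : (n k : ℕ) → List (List (Fin n))
allLists n zero    = [] ∷ []
allLists n (suc k) = concatMap (λ x → map (x ∷_) (allLists n k)) (allFin n)

_∈ᵇ_ : ∀ {n} → Fin n → List (Fin n) → Bool
x ∈ᵇ []       = false
x ∈ᵇ (y ∷ ys) = does (x ≟ᶠ y) ∨ (x ∈ᵇ ys)

distinctᵇ : ∀ {n} → List (Fin n) → Bool
distinctᵇ []       = true
distinctᵇ (x ∷ xs) = not (x ∈ᵇ xs) ∧ distinctᵇ xs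

Ω : (n : ℕ) → List (List (Fin n))
Ω n = filterᵇ distinctᵇ (allLists n n)

-- Pairs are probed in lexicographic order of ranks: for each
-- a (in rank order), for each b of larger rank (in rank order).
-- The state records which nodes are matched (covered by M(σ)).

Covered : ℕ → Set
Covered n = Fin n → Bool

probe : ∀ {n} → Graph n → Fin n → Fin n → Covered n → Covered n
probe G a b c =
  if not (c a) ∧ not (c b) ∧ adj G a b
  then (λ w → does (w ≟ᶠ a) ∨ does (w ≟ᶠ b) ∨ c w)
  else c

probeFrom : ∀ {n} → Graph n → Fin n → List (Fin n) → Covered n → Covered n
probeFrom G a []       c = c
probeFrom G a (b ∷ bs) c = probeFrom G a bs (probe G a b c)

runRanking : ∀ {n} → Graph n → List (Fin n) → Covered n → Covered n
runRanking G []       c = c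
runRanking G (a ∷ as) c = runRanking G as (probeFrom G a as c)

matchedᵇ : ∀ {n} → Graph n → List (Fin n) → Fin n → Bool
matchedᵇ G σ u = runRanking G σ (λ _ → false) u

-- node of rank t (1-based), i.e. σ⁻¹(t)
atRank : ∀ {n} → List (Fin n) → ℕ → Maybe (Fin n)
atRank []       _             = nothing
atRank (x ∷ xs) zero          = nothing
atRank (x ∷ xs) (suc zero)    = just x
atRank (x ∷ xs) (suc (suc t)) = atRank xs (suc t)

isAtRankᵇ : ∀ {n} → List (Fin n) → ℕ → Fin n → Bool
isAtRankᵇ σ t u with atRank σ t
... | just v  = does (u ≟ᶠ v)
... | nothing = false

removeNode : ∀ {n} → Fin n → List (Fin n) → List (Fin n)
removeNode u = filterᵇ (λ v → not (does (u ≟ᶠ v)))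

-- insert x so that it ends up at (1-based) rank i
insertAtRank : ∀ {n} → ℕ → Fin n → List (Fin n) → List (Fin n)
insertAtRank zero          x xs       = x ∷ xs
insertAtRank (suc zero)    x xs       = x ∷ xs
insertAtRank (suc (suc i)) x []       = x ∷ []
insertAtRank (suc (suc i)) x (y ∷ ys) = y ∷ insertAtRank (suc i) x ys

reinsert : ∀ {n} → List (Fin n) → Fin n → ℕ → List (Fin n)
reinsert σ u i = insertAtRank i u (removeNode u σ)

inQᵇ : ∀ {n} → Graph n → ℕ → List (Fin n) → Fin n → Bool
inQᵇ G t σ u = isAtRankᵇ σ t u ∧ matchedᵇ G σ u

inRᵇ : ∀ {n} → Graph n → ℕ → List (Fin n) → Fin n → Bool
inRᵇ G t σ u = isAtRankᵇ σ t u ∧ not (matchedᵇ G σ u)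

inSᵇ : ∀ {n} → Graph n → ℕ → List (Fin n) → Fin n → Bool
inSᵇ G zero          σ u = false
inSᵇ G (suc zero)    σ u = false
inSᵇ G (suc (suc t)) σ u =
  inRᵇ G (suc (suc t)) σ u ∧ not (inRᵇ G (suc t) (reinsert σ u (suc t)) u)

countPairs : (n : ℕ) → (List (Fin n) → Fin n → Bool) → ℕ
countPairs n p =
  length (filterᵇ (λ σu → p (Data.Product.proj₁ σu) (Data.Product.proj₂ σu))
                  (concatMap (λ σ → map (σ Data.Product.,_) (allFin n)) (Ω n)))
  where import Data.Product

-- |Q_t| = n! · x_t   and   |S_t| = n! · α_t
Qcard : ∀ {n} → Graph n → ℕ → ℕ
Qcard {n} G t = countPairs n (inQᵇ G t)

Scard : ∀ {n} → Graph n → ℕ → ℕ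
Scard {n} G t = countPairs n (inSᵇ G t)

sumS : ∀ {n} → Graph n → ℕ → ℕ
sumS G zero    = 0
sumS G (suc t) = sumS G t + Scard G (suc t)

module Submission where

-- Every count is a sum over all length-n words σ of the number of nodes u with
-- (σ,u) in the set, taken to be 0 unless σ is a permutation.  If u has rank t
-- in σ, then τ = σ_u^{t-1} is σ with the letters of ranks t-1 and t swapped.
-- Ranking is monotone: moving an unmatched node one rank later keeps it
-- unmatched.  Hence [u matched in τ] = [u matched in σ] + [(σ,u) ∈ S_t], and
-- since the adjacent transposition is a bijection on words, summing gives the
-- difference identity.  The cumulative identity follows by induction on t from
-- |Q_1| = n! (the first-ranked node probes its partner, which occurs in every
-- permutation) and S_1 = ∅.  That there are n! permutations and that no
-- permutation misses a node are both obtained by counting injective words.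

open import Defs hiding (sym)
open import Data.Nat using (ℕ; zero; suc; pred; _+_; _∸_; _*_; _≤_; _<_; _!; z≤n; s≤s)
open import Data.Nat.Properties
open import Data.Bool using (Bool; true; false; not; _∧_; _∨_; if_then_else_)
open import Data.Bool.Properties using (∧-conicalˡ; ∧-conicalʳ; ∨-conicalˡ; ∨-conicalʳ; ∨-comm; ∨-zeroʳ; ∧-zeroʳ; ∧-comm; ∧-assoc; ∧-identityʳ; ∨-assoc)
open import Data.Fin using (Fin) renaming (zero to fzero; suc to fsuc)
open import Data.Fin.Properties using () renaming (_≟_ to _≟ᶠ_; suc-injective to fsuc-injective)
open import Data.List using (List; []; _∷_; _++_; length; map; concatMap; allFin; filterᵇ; tabulate)
open import Data.List.Properties using (length-tabulate)
open import Data.Maybe using (just)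
open import Data.Product using (_×_; _,_; proj₁; proj₂)
open import Data.Sum using (_⊎_; inj₁; inj₂)
open import Data.Empty using (⊥; ⊥-elim)
open import Function using (id)
open import Relation.Nullary using (does; yes; no)
open import Relation.Nullary.Decidable using (dec-true; dec-false)
open import Relation.Binary.PropositionalEquality
  using (_≡_; _≢_; refl; sym; trans; cong; cong₂; subst; subst₂; module ≡-Reasoning)
open import Algebra.Properties.CommutativeSemigroup +-commutativeSemigroup using (interchange)

⟦_⟧ : Bool → ℕ
⟦ true ⟧  = 1
⟦ false ⟧ = 0

⟦⟧≤1 : ∀ b → ⟦ b ⟧ ≤ 1
⟦⟧≤1 true  = s≤s z≤n
⟦⟧≤1 false = z≤n

bool-cases : ∀ b → (b ≡ true) ⊎ (b ≡ false)
bool-cases true  = inj₁ refl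
bool-cases false = inj₂ refl

if-true : ∀ {A : Set} {b} (x y : A) → b ≡ true → (if b then x else y) ≡ x
if-true x y refl = refl

if-false : ∀ {A : Set} {b} (x y : A) → b ≡ false → (if b then x else y) ≡ y
if-false x y refl = refl

not-true : ∀ b → not b ≡ true → b ≡ false
not-true false refl = refl

-- not (a ∨ b) ∧ (not c ∧ d) is symmetric in b and c; this is how a swap of two
-- letters interacts with distinctness.
not-∨-swap : ∀ a b c d → not (a ∨ b) ∧ (not c ∧ d) ≡ not (a ∨ c) ∧ (not b ∧ d)
not-∨-swap true  b     c     d = refl
not-∨-swap false true  true  d = refl
not-∨-swap false true  false d = refl
not-∨-swap false false true  d = refl
not-∨-swap false false false d = refl

≟-refl : ∀ {n} (v : Fin n) → does (v ≟ᶠ v) ≡ true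
≟-refl v = dec-true (v ≟ᶠ v) refl

≟-≢ : ∀ {n} (u v : Fin n) → u ≢ v → does (u ≟ᶠ v) ≡ false
≟-≢ u v = dec-false (u ≟ᶠ v)

≟-sound : ∀ {n} (u v : Fin n) → does (u ≟ᶠ v) ≡ true → u ≡ v
≟-sound u v e with u ≟ᶠ v
... | yes u≡v = u≡v
≟-sound u v () | no _

≟-sym : ∀ {n} (u v : Fin n) → does (u ≟ᶠ v) ≡ does (v ≟ᶠ u)
≟-sym u v with u ≟ᶠ v | v ≟ᶠ u
... | yes _   | yes _   = refl
... | no _    | no _    = refl
... | yes u≡v | no v≢u  = ⊥-elim (v≢u (sym u≡v))
... | no u≢v  | yes v≡u = ⊥-elim (u≢v (sym v≡u))

∑ : ∀ {A : Set} → List A → (A → ℕ) → ℕ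
∑ []       f = 0
∑ (x ∷ xs) f = f x + ∑ xs f

∑-cong : ∀ {A : Set} (xs : List A) {f g : A → ℕ} → (∀ x → f x ≡ g x) → ∑ xs f ≡ ∑ xs g
∑-cong []       f≡g = refl
∑-cong (x ∷ xs) f≡g = cong₂ _+_ (f≡g x) (∑-cong xs f≡g)

∑-mono : ∀ {A : Set} (xs : List A) {f g : A → ℕ} → (∀ x → f x ≤ g x) → ∑ xs f ≤ ∑ xs g
∑-mono []       f≤g = z≤n
∑-mono (x ∷ xs) f≤g = +-mono-≤ (f≤g x) (∑-mono xs f≤g)

∑-zero : ∀ {A : Set} (xs : List A) → ∑ xs (λ _ → 0) ≡ 0
∑-zero []       = refl
∑-zero (x ∷ xs) = ∑-zero xs

∑-one : ∀ {A : Set} (xs : List A) → ∑ xs (λ _ → 1) ≡ length xs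
∑-one []       = refl
∑-one (x ∷ xs) = cong suc (∑-one xs)

∑-+ : ∀ {A : Set} (xs : List A) (f g : A → ℕ) → ∑ xs (λ x → f x + g x) ≡ ∑ xs f + ∑ xs g
∑-+ []       f g = refl
∑-+ (x ∷ xs) f g = trans (cong (f x + g x +_) (∑-+ xs f g)) (interchange (f x) (g x) _ _)

∑-*ˡ : ∀ {A : Set} (xs : List A) (k : ℕ) (f : A → ℕ) → ∑ xs (λ x → k * f x) ≡ k * ∑ xs f
∑-*ˡ []       k f = sym (*-zeroʳ k)
∑-*ˡ (x ∷ xs) k f = trans (cong (k * f x +_) (∑-*ˡ xs k f)) (sym (*-distribˡ-+ k (f x) _))

∑-*ʳ : ∀ {A : Set} (xs : List A) (k : ℕ) (f : A → ℕ) → ∑ xs (λ x → f x * k) ≡ ∑ xs f * k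
∑-*ʳ xs k f = trans (∑-cong xs (λ x → *-comm (f x) k)) (trans (∑-*ˡ xs k f) (*-comm k _))

∑-++ : ∀ {A : Set} (xs ys : List A) (f : A → ℕ) → ∑ (xs ++ ys) f ≡ ∑ xs f + ∑ ys f
∑-++ []       ys f = refl
∑-++ (x ∷ xs) ys f = trans (cong (f x +_) (∑-++ xs ys f)) (sym (+-assoc (f x) _ _))

∑-concatMap : ∀ {A B : Set} (g : A → List B) (xs : List A) (f : B → ℕ) →
  ∑ (concatMap g xs) f ≡ ∑ xs (λ x → ∑ (g x) f)
∑-concatMap g []       f = refl
∑-concatMap g (x ∷ xs) f = trans (∑-++ (g x) (concatMap g xs) f) (cong (∑ (g x) f +_) (∑-concatMap g xs f))

∑-map : ∀ {A B : Set} (g : A → B) (xs : List A) (f : B → ℕ) → ∑ (map g xs) f ≡ ∑ xs (λ x → f (g x))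
∑-map g []       f = refl
∑-map g (x ∷ xs) f = cong (f (g x) +_) (∑-map g xs f)

∑-filter : ∀ {A : Set} (q : A → Bool) (xs : List A) (f : A → ℕ) →
  ∑ (filterᵇ q xs) f ≡ ∑ xs (λ x → if q x then f x else 0)
∑-filter q []       f = refl
∑-filter q (x ∷ xs) f with q x
... | true  = cong (f x +_) (∑-filter q xs f)
... | false = ∑-filter q xs f

length-filter : ∀ {A : Set} (q : A → Bool) (xs : List A) → length (filterᵇ q xs) ≡ ∑ xs (λ x → ⟦ q x ⟧)
length-filter q []       = refl
length-filter q (x ∷ xs) with q x
... | true  = cong suc (length-filter q xs)
... | false = length-filter q xs

∑-exchange : ∀ {A B : Set} (xs : List A) (ys : List B) (f : A → B → ℕ) →
  ∑ xs (λ x → ∑ ys (f x)) ≡ ∑ ys (λ y → ∑ xs (λ x → f x y))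
∑-exchange []       ys f = sym (∑-zero ys)
∑-exchange (x ∷ xs) ys f =
  trans (cong (∑ ys (f x) +_) (∑-exchange xs ys f)) (sym (∑-+ ys (f x) (λ y → ∑ xs (λ x → f x y))))

∑ᶠ : ∀ n → (Fin n → ℕ) → ℕ
∑ᶠ zero    g = 0
∑ᶠ (suc n) g = g fzero + ∑ᶠ n (λ i → g (fsuc i))

∑-tabulate : ∀ {A : Set} n (h : Fin n → A) (f : A → ℕ) → ∑ (tabulate h) f ≡ ∑ᶠ n (λ i → f (h i))
∑-tabulate zero    h f = refl
∑-tabulate (suc n) h f = cong (f (h fzero) +_) (∑-tabulate n (λ i → h (fsuc i)) f)

∑ᶠ-vanishing : ∀ n (g : Fin n → ℕ) → (∀ u → g u ≡ 0) → ∑ᶠ n g ≡ 0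
∑ᶠ-vanishing zero    g g≡0 = refl
∑ᶠ-vanishing (suc n) g g≡0 = cong₂ _+_ (g≡0 fzero) (∑ᶠ-vanishing n _ (λ u → g≡0 (fsuc u)))

∑ᶠ-point : ∀ n (g : Fin n → ℕ) v → (∀ u → u ≢ v → g u ≡ 0) → ∑ᶠ n g ≡ g v
∑ᶠ-point (suc n) g fzero    g≡0 =
  trans (cong (g fzero +_) (∑ᶠ-vanishing n _ (λ u → g≡0 (fsuc u) (λ ())))) (+-identityʳ _)
∑ᶠ-point (suc n) g (fsuc v) g≡0 =
  trans (cong (_+ ∑ᶠ n (λ i → g (fsuc i))) (g≡0 fzero (λ ())))
        (∑ᶠ-point n (λ i → g (fsuc i)) v (λ u u≢v → g≡0 (fsuc u) (λ e → u≢v (fsuc-injective e))))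

∑ᶠ-≥ : ∀ n (g : Fin n → ℕ) v → g v ≤ ∑ᶠ n g
∑ᶠ-≥ (suc n) g fzero    = m≤m+n _ _
∑ᶠ-≥ (suc n) g (fsuc v) = ≤-trans (∑ᶠ-≥ n (λ i → g (fsuc i)) v) (m≤n+m _ _)

∑-allFin : ∀ n (g : Fin n → ℕ) → ∑ (allFin n) g ≡ ∑ᶠ n g
∑-allFin n g = ∑-tabulate n id g

∑-allFin-point : ∀ n (g : Fin n → ℕ) v → (∀ u → does (u ≟ᶠ v) ≡ false → g u ≡ 0) → ∑ (allFin n) g ≡ g v
∑-allFin-point n g v g≡0 = trans (∑-allFin n g) (∑ᶠ-point n g v (λ u u≢v → g≡0 u (≟-≢ u v u≢v)))

∑-allFin-≥ : ∀ n (g : Fin n → ℕ) v → g v ≤ ∑ (allFin n) g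
∑-allFin-≥ n g v = subst (g v ≤_) (sym (∑-allFin n g)) (∑ᶠ-≥ n g v)

∑-allFin-one : ∀ n → ∑ (allFin n) (λ _ → 1) ≡ n
∑-allFin-one n = trans (∑-one (allFin n)) (length-tabulate id)

allLists-split : ∀ n m (h : List (Fin n) → ℕ) →
  ∑ (allLists n (suc m)) h ≡ ∑ (allFin n) (λ x → ∑ (allLists n m) (λ τ → h (x ∷ τ)))
allLists-split n m h =
  trans (∑-concatMap _ (allFin n) h) (∑-cong (allFin n) (λ x → ∑-map (x ∷_) (allLists n m) h))

∑-words-cong : ∀ n m (f g : List (Fin n) → ℕ) → (∀ σ → length σ ≡ m → f σ ≡ g σ) →
  ∑ (allLists n m) f ≡ ∑ (allLists n m) g
∑-words-cong n zero    f g f≡g = cong (_+ 0) (f≡g [] refl)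
∑-words-cong n (suc m) f g f≡g = begin
  ∑ (allLists n (suc m)) f                                ≡⟨ allLists-split n m f ⟩
  ∑ (allFin n) (λ x → ∑ (allLists n m) (λ τ → f (x ∷ τ))) ≡⟨ ∑-cong (allFin n) (λ x →
      ∑-words-cong n m _ _ (λ τ len → f≡g (x ∷ τ) (cong suc len))) ⟩
  ∑ (allFin n) (λ x → ∑ (allLists n m) (λ τ → g (x ∷ τ))) ≡⟨ sym (allLists-split n m g) ⟩
  ∑ (allLists n (suc m)) g                                ∎
  where open ≡-Reasoning

∑-words-mono : ∀ n m (f g : List (Fin n) → ℕ) → (∀ σ → length σ ≡ m → f σ ≤ g σ) →
  ∑ (allLists n m) f ≤ ∑ (allLists n m) g
∑-words-mono n zero    f g f≤g = +-monoˡ-≤ 0 (f≤g [] refl)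
∑-words-mono n (suc m) f g f≤g =
  subst₂ _≤_ (sym (allLists-split n m f)) (sym (allLists-split n m g))
    (∑-mono (allFin n) (λ x → ∑-words-mono n m _ _ (λ τ len → f≤g (x ∷ τ) (cong suc len))))

-- swapAt k exchanges the letters at positions k and k+1 (0-based).
swapAt : ∀ {A : Set} → ℕ → List A → List A
swapAt zero    (x ∷ y ∷ r) = y ∷ x ∷ r
swapAt zero    xs          = xs
swapAt (suc k) []          = []
swapAt (suc k) (x ∷ r)     = x ∷ swapAt k r

-- An adjacent transposition permutes the words of each length, so it does not
-- change sums over them.
∑-words-swap : ∀ n m k (h : List (Fin n) → ℕ) →
  ∑ (allLists n m) (λ σ → h (swapAt k σ)) ≡ ∑ (allLists n m) h
∑-words-swap n zero          zero    h = refl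
∑-words-swap n zero          (suc k) h = refl
∑-words-swap n (suc zero)    zero    h = trans (allLists-split n 0 _) (sym (allLists-split n 0 h))
∑-words-swap n (suc (suc m)) zero    h =
  trans (allLists-split n (suc m) _)
  (trans (∑-cong (allFin n) (λ x → allLists-split n m _))
  (trans (∑-exchange (allFin n) (allFin n) _)
  (trans (sym (∑-cong (allFin n) (λ x → allLists-split n m _)))
         (sym (allLists-split n (suc m) h)))))
∑-words-swap n (suc m)       (suc k) h =
  trans (allLists-split n m _)
  (trans (∑-cong (allFin n) (λ x → ∑-words-swap n m k (λ τ → h (x ∷ τ))))
         (sym (allLists-split n m h)))

perWord : (n : ℕ) → (List (Fin n) → Fin n → Bool) → List (Fin n) → ℕ
perWord n p σ = if distinctᵇ σ then ∑ (allFin n) (λ u → ⟦ p σ u ⟧) else 0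

countPairs-words : ∀ n p → countPairs n p ≡ ∑ (allLists n n) (perWord n p)
countPairs-words n p =
  trans (length-filter _ (concatMap (λ σ → map (σ ,_) (allFin n)) (Ω n)))
  (trans (∑-concatMap (λ σ → map (σ ,_) (allFin n)) (Ω n) _)
  (trans (∑-cong (Ω n) (λ σ → ∑-map (σ ,_) (allFin n) _))
         (∑-filter distinctᵇ (allLists n n) _)))

isAtRank-just : ∀ {n} (σ : List (Fin n)) t v u → atRank σ t ≡ just v → isAtRankᵇ σ t u ≡ does (u ≟ᶠ v)
isAtRank-just σ t v u e with atRank σ t
isAtRank-just σ t v u refl | just .v = refl

∑-at-rank : ∀ {n} (ρ : List (Fin n)) j v (g : Bool → Fin n → Bool) → atRank ρ j ≡ just v →
  (∀ u → g false u ≡ false) →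
  ∑ (allFin n) (λ u → ⟦ g (isAtRankᵇ ρ j u) u ⟧) ≡ ⟦ g true v ⟧
∑-at-rank {n} ρ j v g at g-false = trans
  (∑-allFin-point n _ v (λ u u≢v →
     trans (cong (λ z → ⟦ g z u ⟧) (trans (isAtRank-just ρ j v u at) u≢v)) (cong ⟦_⟧ (g-false u))))
  (cong (λ z → ⟦ g z v ⟧) (trans (isAtRank-just ρ j v v at) (≟-refl v)))

fall : ℕ → ℕ → ℕ
fall k zero    = 1
fall k (suc m) = k * fall (pred k) m

fall-vanishes : ∀ k m → k < m → fall k m ≡ 0
fall-vanishes zero    (suc m) _          = refl
fall-vanishes (suc k) (suc m) (s≤s k<m) = trans (cong (suc k *_) (fall-vanishes k m k<m)) (*-zeroʳ (suc k))

fall-diag : ∀ k → fall k k ≡ k !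
fall-diag zero    = refl
fall-diag (suc k) = cong (suc k *_) (fall-diag k)

pred<-of-node : ∀ {n} → Fin n → n ∸ 1 < n
pred<-of-node {suc k} _ = n<1+n k

module InjectiveWords {n : ℕ} where

  avoidᵇ : List (Fin n) → List (Fin n) → Bool
  avoidᵇ S []       = true
  avoidᵇ S (y ∷ ys) = not (y ∈ᵇ S) ∧ avoidᵇ S ys

  avoid-nothing : ∀ xs → avoidᵇ [] xs ≡ true
  avoid-nothing []       = refl
  avoid-nothing (y ∷ ys) = avoid-nothing ys

  avoid-cons : ∀ x S τ → avoidᵇ (x ∷ S) τ ≡ not (x ∈ᵇ τ) ∧ avoidᵇ S τ
  avoid-cons x S []       = refl
  avoid-cons x S (y ∷ ys) =
    trans (cong (not (does (y ≟ᶠ x) ∨ y ∈ᵇ S) ∧_) (avoid-cons x S ys))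
    (trans (not-∨-swap (does (y ≟ᶠ x)) (y ∈ᵇ S) (x ∈ᵇ ys) (avoidᵇ S ys))
           (cong (λ z → not (z ∨ x ∈ᵇ ys) ∧ (not (y ∈ᵇ S) ∧ avoidᵇ S ys)) (≟-sym y x)))

  injectiveAvoiding : List (Fin n) → ℕ → ℕ
  injectiveAvoiding S m = ∑ (allLists n m) (λ xs → ⟦ distinctᵇ xs ∧ avoidᵇ S xs ⟧)

  ∑-member : ∀ S → distinctᵇ S ≡ true → ∑ (allFin n) (λ x → ⟦ x ∈ᵇ S ⟧) ≡ length S
  ∑-member []      _ = ∑-zero (allFin n)
  ∑-member (y ∷ S) d = begin
    ∑ (allFin n) (λ x → ⟦ does (x ≟ᶠ y) ∨ x ∈ᵇ S ⟧)
      ≡⟨ ∑-cong (allFin n) split ⟩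
    ∑ (allFin n) (λ x → ⟦ does (x ≟ᶠ y) ⟧ + ⟦ x ∈ᵇ S ⟧)
      ≡⟨ ∑-+ (allFin n) _ _ ⟩
    ∑ (allFin n) (λ x → ⟦ does (x ≟ᶠ y) ⟧) + ∑ (allFin n) (λ x → ⟦ x ∈ᵇ S ⟧)
      ≡⟨ cong₂ _+_ only-y (∑-member S (∧-conicalʳ _ _ d)) ⟩
    suc (length S) ∎
    where
      open ≡-Reasoning
      y∉S : y ∈ᵇ S ≡ false
      y∉S = not-true _ (∧-conicalˡ _ _ d)
      split : ∀ x → ⟦ does (x ≟ᶠ y) ∨ x ∈ᵇ S ⟧ ≡ ⟦ does (x ≟ᶠ y) ⟧ + ⟦ x ∈ᵇ S ⟧
      split x with bool-cases (does (x ≟ᶠ y))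
      ... | inj₂ x≢y rewrite x≢y = refl
      ... | inj₁ x≡y with ≟-sound x y x≡y
      ...   | refl rewrite x≡y | y∉S = refl
      only-y : ∑ (allFin n) (λ x → ⟦ does (x ≟ᶠ y) ⟧) ≡ 1
      only-y = trans (∑-allFin-point n _ y (λ u e → cong ⟦_⟧ e)) (cong ⟦_⟧ (≟-refl y))

  ∑-nonmember : ∀ S → distinctᵇ S ≡ true → ∑ (allFin n) (λ x → ⟦ not (x ∈ᵇ S) ⟧) ≡ n ∸ length S
  ∑-nonmember S d = begin
    nonmembers                                                  ≡⟨ sym (m+n∸m≡n (length S) nonmembers) ⟩
    (length S + nonmembers) ∸ length S                          ≡⟨ cong (λ z → (z + nonmembers) ∸ length S) (sym (∑-member S d)) ⟩
    (∑ (allFin n) (λ x → ⟦ x ∈ᵇ S ⟧) + nonmembers) ∸ length S  ≡⟨ cong (_∸ length S) (sym (∑-+ (allFin n) _ _)) ⟩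
    ∑ (allFin n) (λ x → ⟦ x ∈ᵇ S ⟧ + ⟦ not (x ∈ᵇ S) ⟧) ∸ length S ≡⟨ cong (_∸ length S) (∑-cong (allFin n) (λ x → one (x ∈ᵇ S))) ⟩
    ∑ (allFin n) (λ _ → 1) ∸ length S                           ≡⟨ cong (_∸ length S) (∑-allFin-one n) ⟩
    n ∸ length S                                                ∎
    where
      open ≡-Reasoning
      nonmembers = ∑ (allFin n) (λ x → ⟦ not (x ∈ᵇ S) ⟧)
      one : ∀ b → ⟦ b ⟧ + ⟦ not b ⟧ ≡ 1
      one true  = refl
      one false = refl

  -- Choosing the first letter x ∉ S of an injective word avoiding S leaves an
  -- injective word avoiding x ∷ S.
  first-letter : ∀ a b c d → ⟦ (not a ∧ b) ∧ (not c ∧ d) ⟧ ≡ ⟦ not c ⟧ * ⟦ b ∧ (not a ∧ d) ⟧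
  first-letter a b true  d = cong ⟦_⟧ (∧-zeroʳ (not a ∧ b))
  first-letter a b false d =
    trans (cong ⟦_⟧ (trans (cong (_∧ d) (∧-comm (not a) b)) (∧-assoc b (not a) d))) (sym (+-identityʳ _))

  count-injective : ∀ m S → distinctᵇ S ≡ true → injectiveAvoiding S m ≡ fall (n ∸ length S) m
  count-injective zero    S d = refl
  count-injective (suc m) S d = begin
    injectiveAvoiding S (suc m)
      ≡⟨ allLists-split n m _ ⟩
    ∑ (allFin n) (λ x → ∑ (allLists n m) (λ τ → ⟦ distinctᵇ (x ∷ τ) ∧ avoidᵇ S (x ∷ τ) ⟧))
      ≡⟨ ∑-cong (allFin n) (λ x → trans (∑-cong (allLists n m) (λ τ → by-first-letter x τ))
                                         (∑-*ˡ (allLists n m) ⟦ not (x ∈ᵇ S) ⟧ _)) ⟩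
    ∑ (allFin n) (λ x → ⟦ not (x ∈ᵇ S) ⟧ * injectiveAvoiding (x ∷ S) m)
      ≡⟨ ∑-cong (allFin n) recurse ⟩
    ∑ (allFin n) (λ x → ⟦ not (x ∈ᵇ S) ⟧ * fall (n ∸ suc (length S)) m)
      ≡⟨ ∑-*ʳ (allFin n) _ _ ⟩
    ∑ (allFin n) (λ x → ⟦ not (x ∈ᵇ S) ⟧) * fall (n ∸ suc (length S)) m
      ≡⟨ cong₂ (λ a b → a * fall b m) (∑-nonmember S d) (sym (pred[m∸n]≡m∸[1+n] n (length S))) ⟩
    fall (n ∸ length S) (suc m) ∎
    where
      open ≡-Reasoning
      by-first-letter : ∀ x τ → ⟦ distinctᵇ (x ∷ τ) ∧ avoidᵇ S (x ∷ τ) ⟧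
                              ≡ ⟦ not (x ∈ᵇ S) ⟧ * ⟦ distinctᵇ τ ∧ avoidᵇ (x ∷ S) τ ⟧
      by-first-letter x τ =
        trans (first-letter (x ∈ᵇ τ) (distinctᵇ τ) (x ∈ᵇ S) (avoidᵇ S τ))
              (cong (λ z → ⟦ not (x ∈ᵇ S) ⟧ * ⟦ distinctᵇ τ ∧ z ⟧) (sym (avoid-cons x S τ)))
      recurse : ∀ x → ⟦ not (x ∈ᵇ S) ⟧ * injectiveAvoiding (x ∷ S) m
                    ≡ ⟦ not (x ∈ᵇ S) ⟧ * fall (n ∸ suc (length S)) m
      recurse x with x ∈ᵇ S in x∈S
      ... | true  = refl
      ... | false = cong (_+ 0) (count-injective m (x ∷ S) (trans (cong (λ z → not z ∧ distinctᵇ S) x∈S) d))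

  count-permutations : ∑ (allLists n n) (λ σ → ⟦ distinctᵇ σ ⟧) ≡ n !
  count-permutations = begin
    ∑ (allLists n n) (λ σ → ⟦ distinctᵇ σ ⟧)
      ≡⟨ ∑-cong (allLists n n) (λ σ → cong ⟦_⟧ (sym (trans (cong (distinctᵇ σ ∧_) (avoid-nothing σ))
                                                              (∧-identityʳ (distinctᵇ σ))))) ⟩
    injectiveAvoiding [] n ≡⟨ count-injective n [] refl ⟩
    fall n n               ≡⟨ fall-diag n ⟩
    n !                    ∎
    where open ≡-Reasoning

  missing : List (Fin n) → ℕ
  missing σ = ∑ (allFin n) (λ x → ⟦ distinctᵇ σ ∧ avoidᵇ (x ∷ []) σ ⟧)

  no-missing : ∑ (allLists n n) missing ≡ 0
  no-missing = trans (∑-exchange (allLists n n) (allFin n) _)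
    (trans (∑-cong (allFin n) (λ x → trans (count-injective n (x ∷ []) refl) (fall-vanishes (n ∸ 1) n (pred<-of-node x))))
           (∑-zero (allFin n)))

-- A word with at least k+2 letters, seen around its ranks k+1 and k+2.
data AroundRank {n} (k : ℕ) : List (Fin n) → Set where
  around : ∀ pre w u post → length pre ≡ k → AroundRank k (pre ++ w ∷ u ∷ post)

aroundRank : ∀ {n} k (σ : List (Fin n)) → suc (suc k) ≤ length σ → AroundRank k σ
aroundRank zero    (w ∷ u ∷ post) _ = around [] w u post refl
aroundRank zero    (x ∷ [])       (s≤s ())
aroundRank (suc k) (x ∷ σ) (s≤s k+2≤) with aroundRank k σ k+2≤
... | around pre w u post len = around (x ∷ pre) w u post (cong suc len)

atRank-after : ∀ {n} (pre : List (Fin n)) x rest → atRank (pre ++ x ∷ rest) (suc (length pre)) ≡ just x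
atRank-after []        x rest = refl
atRank-after (p ∷ pre) x rest = atRank-after pre x rest

atRank-after₂ : ∀ {n} (pre : List (Fin n)) x y rest → atRank (pre ++ x ∷ y ∷ rest) (suc (suc (length pre))) ≡ just y
atRank-after₂ []        x y rest = refl
atRank-after₂ (p ∷ pre) x y rest = atRank-after₂ pre x y rest

swapAt-around : ∀ {n} (pre : List (Fin n)) w u post → swapAt (length pre) (pre ++ w ∷ u ∷ post) ≡ pre ++ u ∷ w ∷ post
swapAt-around []        w u post = refl
swapAt-around (p ∷ pre) w u post = cong (p ∷_) (swapAt-around pre w u post)

insertAtRank-after : ∀ {n} (pre : List (Fin n)) u rest → insertAtRank (suc (length pre)) u (pre ++ rest) ≡ pre ++ u ∷ rest
insertAtRank-after []        u rest = refl
insertAtRank-after (p ∷ pre) u rest = cong (p ∷_) (insertAtRank-after pre u rest)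

∈-++ : ∀ {n} (x : Fin n) ys zs → x ∈ᵇ (ys ++ zs) ≡ x ∈ᵇ ys ∨ x ∈ᵇ zs
∈-++ x []       zs = refl
∈-++ x (y ∷ ys) zs = trans (cong (does (x ≟ᶠ y) ∨_) (∈-++ x ys zs)) (sym (∨-assoc (does (x ≟ᶠ y)) _ _))

∈-swap : ∀ {n} (x : Fin n) pre w u post → x ∈ᵇ (pre ++ w ∷ u ∷ post) ≡ x ∈ᵇ (pre ++ u ∷ w ∷ post)
∈-swap x []        w u post = trans (sym (∨-assoc (does (x ≟ᶠ w)) _ _))
  (trans (cong (_∨ x ∈ᵇ post) (∨-comm (does (x ≟ᶠ w)) _)) (∨-assoc (does (x ≟ᶠ u)) _ _))
∈-swap x (p ∷ pre) w u post = cong (does (x ≟ᶠ p) ∨_) (∈-swap x pre w u post)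

distinct-swap : ∀ {n} (pre : List (Fin n)) w u post → distinctᵇ (pre ++ w ∷ u ∷ post) ≡ distinctᵇ (pre ++ u ∷ w ∷ post)
distinct-swap []        w u post =
  trans (not-∨-swap (does (w ≟ᶠ u)) (w ∈ᵇ post) (u ∈ᵇ post) (distinctᵇ post))
        (cong (λ z → not (z ∨ u ∈ᵇ post) ∧ (not (w ∈ᵇ post) ∧ distinctᵇ post)) (≟-sym w u))
distinct-swap (p ∷ pre) w u post = cong₂ _∧_ (cong not (∈-swap p pre w u post)) (distinct-swap pre w u post)

removeNode-skip : ∀ {n} (u x : Fin n) xs → does (u ≟ᶠ x) ≡ false → removeNode u (x ∷ xs) ≡ x ∷ removeNode u xs
removeNode-skip u x xs u≢x rewrite u≢x = refl

removeNode-absent : ∀ {n} (u : Fin n) xs → u ∈ᵇ xs ≡ false → removeNode u xs ≡ xs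
removeNode-absent u []       _   = refl
removeNode-absent u (x ∷ xs) u∉ =
  trans (removeNode-skip u x xs (∨-conicalˡ _ _ u∉)) (cong (x ∷_) (removeNode-absent u xs (∨-conicalʳ _ _ u∉)))

removeNode-around : ∀ {n} (pre : List (Fin n)) w u post → distinctᵇ (pre ++ w ∷ u ∷ post) ≡ true →
  removeNode u (pre ++ w ∷ u ∷ post) ≡ pre ++ w ∷ post
removeNode-around [] w u post d =
  trans (removeNode-skip u w (u ∷ post) (trans (≟-sym u w) w≢u))
        (cong (w ∷_) (trans removeNode-hit (removeNode-absent u post u∉post)))
  where
    w≢u : does (w ≟ᶠ u) ≡ false
    w≢u = ∨-conicalˡ _ _ (not-true _ (∧-conicalˡ _ _ d))
    u∉post : u ∈ᵇ post ≡ false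
    u∉post = not-true _ (∧-conicalˡ _ (distinctᵇ post) (∧-conicalʳ (not (w ∈ᵇ (u ∷ post))) _ d))
    removeNode-hit : removeNode u (u ∷ post) ≡ removeNode u post
    removeNode-hit rewrite ≟-refl u = refl
removeNode-around (p ∷ pre) w u post d =
  trans (removeNode-skip u p _ (trans (≟-sym u p) p≢u)) (cong (p ∷_) (removeNode-around pre w u post (∧-conicalʳ _ _ d)))
  where
    p∉ : p ∈ᵇ pre ∨ p ∈ᵇ (w ∷ u ∷ post) ≡ false
    p∉ = trans (sym (∈-++ p pre _)) (not-true _ (∧-conicalˡ _ _ d))
    p≢u : does (p ≟ᶠ u) ≡ false
    p≢u = ∨-conicalˡ _ _ (∨-conicalʳ (does (p ≟ᶠ w)) _ (∨-conicalʳ (p ∈ᵇ pre) _ p∉))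

-- σ_u^{t-1} for the node u of rank t = k+2 swaps the letters of ranks k+1, k+2.
reinsert-around : ∀ {n} (pre : List (Fin n)) w u post → distinctᵇ (pre ++ w ∷ u ∷ post) ≡ true →
  reinsert (pre ++ w ∷ u ∷ post) u (suc (length pre)) ≡ pre ++ u ∷ w ∷ post
reinsert-around pre w u post d =
  trans (cong (insertAtRank (suc (length pre)) u) (removeNode-around pre w u post d))
        (insertAtRank-after pre u (w ∷ post))

module RankingMonotone {n : ℕ} (G : Graph n) where

  fires : Covered n → Fin n → Fin n → Bool
  fires c a b = not (c a) ∧ not (c b) ∧ adj G a b

  _⊑_ : Covered n → Covered n → Set
  c ⊑ d = ∀ x → c x ≡ true → d x ≡ true

  _≗_ : Covered n → Covered n → Set
  c ≗ d = ∀ x → c x ≡ d x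

  ⊑-refl : ∀ {c} → c ⊑ c
  ⊑-refl x cx = cx

  ⊑-trans : ∀ {c d e} → c ⊑ d → d ⊑ e → c ⊑ e
  ⊑-trans c⊑d d⊑e x cx = d⊑e x (c⊑d x cx)

  uncovered-before : ∀ {c d} x → c ⊑ d → d x ≡ false → c x ≡ false
  uncovered-before {c} x c⊑d dx with c x in cx
  ... | false = refl
  ... | true with trans (sym (c⊑d x cx)) dx
  ...   | ()

  stays-covered : ∀ {c d} u → c ⊑ d → c u ≡ true → d u ≡ false → ⊥
  stays-covered u c⊑d cu du with trans (sym (c⊑d u cu)) du
  ... | ()

  probe-idle : ∀ a b c → fires c a b ≡ false → probe G a b c ≡ c
  probe-idle a b c = if-false _ c

  probe-fired : ∀ a b c x → fires c a b ≡ true → probe G a b c x ≡ (does (x ≟ᶠ a) ∨ does (x ≟ᶠ b) ∨ c x)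
  probe-fired a b c x f = cong (λ d → d x) (if-true _ c f)

  probe-covers-a : ∀ a b c → fires c a b ≡ true → probe G a b c a ≡ true
  probe-covers-a a b c f = trans (probe-fired a b c a f) (cong (λ z → z ∨ does (a ≟ᶠ b) ∨ c a) (≟-refl a))

  probe-covers-b : ∀ a b c → fires c a b ≡ true → probe G a b c b ≡ true
  probe-covers-b a b c f = trans (probe-fired a b c b f)
    (trans (cong (λ z → does (b ≟ᶠ a) ∨ z ∨ c b) (≟-refl b)) (∨-zeroʳ (does (b ≟ᶠ a))))

  probe-grows : ∀ a b c → c ⊑ probe G a b c
  probe-grows a b c x cx with bool-cases (fires c a b)
  ... | inj₂ f = trans (cong (λ d → d x) (probe-idle a b c f)) cx
  ... | inj₁ f = trans (probe-fired a b c x f)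
    (trans (cong (λ z → does (x ≟ᶠ a) ∨ does (x ≟ᶠ b) ∨ z) cx)
           (trans (cong (does (x ≟ᶠ a) ∨_) (∨-zeroʳ (does (x ≟ᶠ b)))) (∨-zeroʳ (does (x ≟ᶠ a)))))

  probeFrom-grows : ∀ a xs c → c ⊑ probeFrom G a xs c
  probeFrom-grows a []       c = ⊑-refl
  probeFrom-grows a (b ∷ xs) c = ⊑-trans (probe-grows a b c) (probeFrom-grows a xs (probe G a b c))

  run-grows : ∀ xs c → c ⊑ runRanking G xs c
  run-grows []       c = ⊑-refl
  run-grows (a ∷ xs) c = ⊑-trans (probeFrom-grows a xs c) (run-grows xs (probeFrom G a xs c))

  fires-cong : ∀ {c d} a b → c ≗ d → fires c a b ≡ fires d a b
  fires-cong a b c≗d = cong₂ (λ p q → not p ∧ not q ∧ adj G a b) (c≗d a) (c≗d b)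

  probe-cong : ∀ {c d} a b → c ≗ d → probe G a b c ≗ probe G a b d
  probe-cong {c} {d} a b c≗d x with bool-cases (fires d a b)
  ... | inj₂ f = trans (cong (λ e → e x) (probe-idle a b c (trans (fires-cong a b c≗d) f)))
                       (trans (c≗d x) (sym (cong (λ e → e x) (probe-idle a b d f))))
  ... | inj₁ f = trans (probe-fired a b c x (trans (fires-cong a b c≗d) f))
                       (trans (cong (λ z → does (x ≟ᶠ a) ∨ does (x ≟ᶠ b) ∨ z) (c≗d x)) (sym (probe-fired a b d x f)))

  probeFrom-cong : ∀ {c d} a xs → c ≗ d → probeFrom G a xs c ≗ probeFrom G a xs d
  probeFrom-cong a []       c≗d = c≗d
  probeFrom-cong a (b ∷ xs) c≗d = probeFrom-cong a xs (probe-cong a b c≗d)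

  run-cong : ∀ {c d} xs → c ≗ d → runRanking G xs c ≗ runRanking G xs d
  run-cong []       c≗d = c≗d
  run-cong (a ∷ xs) c≗d = run-cong xs (probeFrom-cong a xs c≗d)

  fires-anti : ∀ {c d} a b → c ⊑ d → d b ≡ false → fires c a b ≡ false → fires d a b ≡ false
  fires-anti {c} {d} a b c⊑d db fc with d a in da
  ... | true  = refl
  ... | false rewrite uncovered-before a c⊑d da | uncovered-before b c⊑d db | db = fc

  fires-sym : ∀ c a b → fires c a b ≡ fires c b a
  fires-sym c a b rewrite Graph.sym G a b with c a | c b
  ... | true  | true  = refl
  ... | true  | false = refl
  ... | false | true  = refl
  ... | false | false = refl

  probe-commute : ∀ a w u c → c u ≡ false → probe G a w (probe G a u c) u ≡ false →
    probe G a u (probe G a w c) ≗ probe G a w (probe G a u c)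
  probe-commute a w u c cu free with bool-cases (fires c a u)
  ... | inj₁ f = ⊥-elim (stays-covered u (probe-grows a w (probe G a u c)) (probe-covers-b a u c f) free)
  ... | inj₂ f = λ x → trans (cong (λ e → e x) (probe-idle a u (probe G a w c) (fires-anti a u (probe-grows a w c) free′ f)))
                             (cong (λ e → probe G a w e x) (sym idle))
    where
      idle = probe-idle a u c f
      free′ = trans (cong (λ e → probe G a w e u) (sym idle)) free

  probeFrom-swap : ∀ a w u post xs c → probeFrom G a (xs ++ u ∷ w ∷ post) c u ≡ false →
    probeFrom G a (xs ++ w ∷ u ∷ post) c ≗ probeFrom G a (xs ++ u ∷ w ∷ post) c
  probeFrom-swap a w u post []       c free = probeFrom-cong a post (probe-commute a w u c cu free′)
    where
      free′ = uncovered-before u (probeFrom-grows a post (probe G a w (probe G a u c))) free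
      cu = uncovered-before u (⊑-trans (probe-grows a u c) (probe-grows a w _)) free′
  probeFrom-swap a w u post (x ∷ xs) c free = probeFrom-swap a w u post xs (probe G a x c) free

  probeFrom-idle : ∀ u xs c e → probeFrom G u xs c u ≡ false → c ⊑ e → e u ≡ false → probeFrom G u xs e ≗ e
  probeFrom-idle u []       c e free c⊑e eu y = refl
  probeFrom-idle u (x ∷ xs) c e free c⊑e eu with bool-cases (fires c u x)
  ... | inj₁ f = ⊥-elim (stays-covered u (probeFrom-grows u xs (probe G u x c)) (probe-covers-a u x c f) free)
  ... | inj₂ f = λ y → trans (cong (λ d → probeFrom G u xs d y) (probe-idle u x e fe)) (probeFrom-idle u xs c e free′ c⊑e eu y)
    where
      free′ = trans (cong (λ d → probeFrom G u xs d u) (sym (probe-idle u x c f))) free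
      fe = trans (fires-sym e u x) (fires-anti x u c⊑e eu (trans (sym (fires-sym c u x)) f))

  unmatched-later : ∀ w u post pre c → runRanking G (pre ++ u ∷ w ∷ post) c u ≡ false →
    runRanking G (pre ++ w ∷ u ∷ post) c u ≡ false
  unmatched-later w u post (a ∷ pre) c free =
    trans (run-cong (pre ++ w ∷ u ∷ post) (probeFrom-swap a w u post pre c free-after-a) u)
          (unmatched-later w u post pre d free)
    where
      d = probeFrom G a (pre ++ u ∷ w ∷ post) c
      free-after-a = uncovered-before u (run-grows (pre ++ u ∷ w ∷ post) d) free
  unmatched-later w u post [] c free with bool-cases (fires c u w)
  ... | inj₁ f = ⊥-elim (stays-covered u
        (⊑-trans (probeFrom-grows u post _) (⊑-trans (probeFrom-grows w post _) (run-grows post _))) (probe-covers-a u w c f) free)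
  ... | inj₂ f = trans (cong (λ e → runRanking G post (probeFrom G u post (probeFrom G w post e)) u) idle-wu)
                       (trans (run-cong post u-idle₂ u) free₂)
    where
      idle-uw = probe-idle u w c f
      idle-wu = probe-idle w u c (trans (fires-sym c w u) f)
      free₁ = trans (cong (λ e → runRanking G post (probeFrom G w post (probeFrom G u post e)) u) (sym idle-uw)) free
      u-probes-idle = uncovered-before u (⊑-trans (probeFrom-grows w post _) (run-grows post _)) free₁
      cu = uncovered-before u (probeFrom-grows u post c) u-probes-idle
      u-idle₁ = probeFrom-idle u post c c u-probes-idle ⊑-refl cu
      after-w = probeFrom G w post c
      free₂ = trans (sym (run-cong post (probeFrom-cong w post u-idle₁) u)) free₁
      u-idle₂ = probeFrom-idle u post c after-w u-probes-idle (probeFrom-grows w post c)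
                  (uncovered-before u (run-grows post after-w) free₂)

  -- The first-ranked node v probes all others from the empty matching, so it is
  -- matched as soon as one of its neighbours occurs in σ.
  probeFrom-hits : ∀ v b xs c → (∀ x → c x ≡ false) → adj G v b ≡ true → b ∈ᵇ xs ≡ true → probeFrom G v xs c v ≡ true
  probeFrom-hits v b []       c empty vb ()
  probeFrom-hits v b (x ∷ xs) c empty vb b∈ with bool-cases (fires c v x)
  ... | inj₁ f = probeFrom-grows v xs _ v (probe-covers-a v x c f)
  ... | inj₂ f = trans (cong (λ d → probeFrom G v xs d v) (probe-idle v x c f)) (probeFrom-hits v b xs c empty vb b∈xs)
    where
      vx : adj G v x ≡ false
      vx = trans (sym (cong₂ (λ p q → not p ∧ not q ∧ adj G v x) (empty v) (empty x))) f
      b≢x : does (b ≟ᶠ x) ≡ false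
      b≢x with bool-cases (does (b ≟ᶠ x))
      ... | inj₂ e = e
      ... | inj₁ e with trans (sym vb) (trans (cong (adj G v) (≟-sound b x e)) vx)
      ...   | ()
      b∈xs : b ∈ᵇ xs ≡ true
      b∈xs = trans (sym (cong (_∨ b ∈ᵇ xs) b≢x)) b∈

  first-matched : ∀ v b rest → adj G v b ≡ true → b ∈ᵇ rest ≡ true → matchedᵇ G (v ∷ rest) v ≡ true
  first-matched v b rest vb b∈ = run-grows rest _ v (probeFrom-hits v b rest (λ _ → false) (λ _ → refl) vb b∈)

module Difference {n : ℕ} (G : Graph n) where
  open RankingMonotone G using (unmatched-later)

  -- [matched earlier] = [matched later] + [unmatched later, matched earlier],
  -- valid because being unmatched earlier forces being unmatched later.
  indicator-split : ∀ a b → (b ≡ false → a ≡ false) → ⟦ b ⟧ ≡ ⟦ a ⟧ + ⟦ not a ∧ not (not b) ⟧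
  indicator-split true  true  _ = refl
  indicator-split false true  _ = refl
  indicator-split false false _ = refl
  indicator-split true  false later-unmatched with later-unmatched refl
  ... | ()

  -- Let σ = pre ++ w ∷ u ∷ post be a permutation, so u has rank t = |pre| + 2,
  -- and let τ = pre ++ u ∷ w ∷ post = σ_u^{t-1}.  Only u can contribute to the
  -- counts below, since they all fix the rank of the node.
  module _ (pre : List (Fin n)) (w u : Fin n) (post : List (Fin n))
           (distinct : distinctᵇ (pre ++ w ∷ u ∷ post) ≡ true) where
    private
      σ τ : List (Fin n)
      σ = pre ++ w ∷ u ∷ post
      τ = pre ++ u ∷ w ∷ post
      t-1 : ℕ
      t-1 = suc (length pre)

    Q-swapped : perWord n (inQᵇ G t-1) τ ≡ ⟦ matchedᵇ G τ u ⟧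
    Q-swapped = trans (if-true _ 0 (trans (sym (distinct-swap pre w u post)) distinct))
      (∑-at-rank τ t-1 u (λ b x → b ∧ matchedᵇ G τ x) (atRank-after pre u (w ∷ post)) (λ _ → refl))

    Q-original : perWord n (inQᵇ G (suc t-1)) σ ≡ ⟦ matchedᵇ G σ u ⟧
    Q-original = trans (if-true _ 0 distinct)
      (∑-at-rank σ (suc t-1) u (λ b x → b ∧ matchedᵇ G σ x) (atRank-after₂ pre w u post) (λ _ → refl))

    S-original : perWord n (inSᵇ G (suc t-1)) σ ≡ ⟦ not (matchedᵇ G σ u) ∧ not (not (matchedᵇ G τ u)) ⟧
    S-original = trans (if-true _ 0 distinct)
      (trans (∑-at-rank σ (suc t-1) u
                (λ b x → (b ∧ not (matchedᵇ G σ x)) ∧ not (inRᵇ G t-1 (reinsert σ x t-1) x))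
                (atRank-after₂ pre w u post) (λ _ → refl))
             (cong (λ z → ⟦ not (matchedᵇ G σ u) ∧ not z ⟧) R-swapped))
      where
        R-swapped : inRᵇ G t-1 (reinsert σ u t-1) u ≡ not (matchedᵇ G τ u)
        R-swapped = trans (cong (λ ρ → inRᵇ G t-1 ρ u) (reinsert-around pre w u post distinct))
          (cong (_∧ not (matchedᵇ G τ u)) (trans (isAtRank-just τ t-1 u u (atRank-after pre u (w ∷ post))) (≟-refl u)))

    Q-S-permutation : perWord n (inQᵇ G t-1) τ ≡ perWord n (inQᵇ G (suc t-1)) σ + perWord n (inSᵇ G (suc t-1)) σ
    Q-S-permutation = begin
      perWord n (inQᵇ G t-1) τ
        ≡⟨ Q-swapped ⟩
      ⟦ matchedᵇ G τ u ⟧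
        ≡⟨ indicator-split (matchedᵇ G σ u) (matchedᵇ G τ u) (unmatched-later w u post pre (λ _ → false)) ⟩
      ⟦ matchedᵇ G σ u ⟧ + ⟦ not (matchedᵇ G σ u) ∧ not (not (matchedᵇ G τ u)) ⟧
        ≡⟨ sym (cong₂ _+_ Q-original S-original) ⟩
      perWord n (inQᵇ G (suc t-1)) σ + perWord n (inSᵇ G (suc t-1)) σ ∎
      where open ≡-Reasoning

  Q-S-word : ∀ k → suc (suc k) ≤ n → ∀ σ → length σ ≡ n →
    perWord n (inQᵇ G (suc k)) (swapAt k σ) ≡ perWord n (inQᵇ G (suc (suc k))) σ + perWord n (inSᵇ G (suc (suc k))) σ
  Q-S-word k k+2≤n σ len with aroundRank k σ (subst (suc (suc k) ≤_) (sym len) k+2≤n)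
  ... | around pre w u post refl rewrite swapAt-around pre w u post
      with bool-cases (distinctᵇ (pre ++ w ∷ u ∷ post))
  ...   | inj₁ d = Q-S-permutation pre w u post d
  ...   | inj₂ d = trans (if-false _ 0 (trans (sym (distinct-swap pre w u post)) d))
                         (sym (cong₂ _+_ (if-false _ 0 d) (if-false _ 0 d)))

  Q-difference : ∀ k → suc (suc k) ≤ n → Qcard G (suc k) ≡ Qcard G (suc (suc k)) + Scard G (suc (suc k))
  Q-difference k k+2≤n = begin
    Qcard G (suc k)
      ≡⟨ countPairs-words n _ ⟩
    ∑ (allLists n n) (perWord n (inQᵇ G (suc k)))
      ≡⟨ sym (∑-words-swap n n k _) ⟩
    ∑ (allLists n n) (λ σ → perWord n (inQᵇ G (suc k)) (swapAt k σ))
      ≡⟨ ∑-words-cong n n _ _ (Q-S-word k k+2≤n) ⟩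
    ∑ (allLists n n) (λ σ → perWord n (inQᵇ G (suc (suc k))) σ + perWord n (inSᵇ G (suc (suc k))) σ)
      ≡⟨ ∑-+ (allLists n n) _ _ ⟩
    ∑ (allLists n n) (perWord n (inQᵇ G (suc (suc k)))) + ∑ (allLists n n) (perWord n (inSᵇ G (suc (suc k))))
      ≡⟨ sym (cong₂ _+_ (countPairs-words n _) (countPairs-words n _)) ⟩
    Qcard G (suc (suc k)) + Scard G (suc (suc k)) ∎
    where open ≡-Reasoning

module Base {n : ℕ} (G : Graph n) (PM : HasPerfectMatching G) where
  open RankingMonotone G using (first-matched)
  open InjectiveWords {n}

  partner : Fin n → Fin n
  partner = proj₁ PM

  partner-adj : ∀ v → adj G v (partner v) ≡ true
  partner-adj = proj₁ (proj₂ PM)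

  partner-≢ : ∀ v → partner v ≢ v
  partner-≢ v e with trans (sym (partner-adj v)) (trans (cong (adj G v) e) (irref G v))
  ... | ()

  Q₁-first : ∀ v rest → distinctᵇ (v ∷ rest) ≡ true → perWord n (inQᵇ G 1) (v ∷ rest) ≡ ⟦ matchedᵇ G (v ∷ rest) v ⟧
  Q₁-first v rest d = trans (if-true _ 0 d)
    (∑-at-rank (v ∷ rest) 1 v (λ b x → b ∧ matchedᵇ G (v ∷ rest) x) refl (λ _ → refl))

  Q₁-upper : ∀ σ → perWord n (inQᵇ G 1) σ ≤ ⟦ distinctᵇ σ ⟧
  Q₁-upper []         = subst (_≤ 1) (sym (∑-zero (allFin n))) z≤n
  Q₁-upper (v ∷ rest) with bool-cases (distinctᵇ (v ∷ rest))
  ... | inj₁ d = subst₂ _≤_ (sym (Q₁-first v rest d)) (cong ⟦_⟧ (sym d)) (⟦⟧≤1 _)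
  ... | inj₂ d rewrite d = z≤n

  -- If the first-ranked node v of a permutation is unmatched, its partner does
  -- not occur in it; so every permutation counts in Q_1 or misses a node.
  Q₁-lower : ∀ v rest → ⟦ distinctᵇ (v ∷ rest) ⟧ ≤ perWord n (inQᵇ G 1) (v ∷ rest) + missing (v ∷ rest)
  Q₁-lower v rest with bool-cases (distinctᵇ (v ∷ rest))
  ... | inj₂ d rewrite d = z≤n
  ... | inj₁ d with bool-cases (matchedᵇ G (v ∷ rest) v)
  ...   | inj₁ matched = begin
      ⟦ distinctᵇ (v ∷ rest) ⟧                              ≡⟨ cong ⟦_⟧ (trans d (sym matched)) ⟩
      ⟦ matchedᵇ G (v ∷ rest) v ⟧                           ≡⟨ sym (Q₁-first v rest d) ⟩
      perWord n (inQᵇ G 1) (v ∷ rest)                       ≤⟨ m≤m+n _ _ ⟩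
      perWord n (inQᵇ G 1) (v ∷ rest) + missing (v ∷ rest) ∎
    where open ≤-Reasoning
  ...   | inj₂ unmatched = begin
      ⟦ distinctᵇ (v ∷ rest) ⟧                                 ≡⟨ cong ⟦_⟧ (trans d (sym partner-missing)) ⟩
      ⟦ distinctᵇ (v ∷ rest) ∧ avoidᵇ (partner v ∷ []) (v ∷ rest) ⟧ ≤⟨ ∑-allFin-≥ n _ (partner v) ⟩
      missing (v ∷ rest)                                       ≤⟨ m≤n+m _ _ ⟩
      perWord n (inQᵇ G 1) (v ∷ rest) + missing (v ∷ rest)    ∎
    where
      open ≤-Reasoning
      partner∉ : partner v ∈ᵇ (v ∷ rest) ≡ false
      partner∉ with bool-cases (partner v ∈ᵇ rest)
      ... | inj₂ ∉rest = trans (cong (_∨ partner v ∈ᵇ rest) (≟-≢ (partner v) v (partner-≢ v))) ∉rest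
      ... | inj₁ ∈rest with trans (sym (first-matched v (partner v) rest (partner-adj v) ∈rest)) unmatched
      ...   | ()
      partner-missing : distinctᵇ (v ∷ rest) ∧ avoidᵇ (partner v ∷ []) (v ∷ rest) ≡ true
      partner-missing = trans (cong₂ _∧_ d (avoid-cons (partner v) [] (v ∷ rest)))
                              (cong₂ (λ p q → not p ∧ q) partner∉ (avoid-nothing (v ∷ rest)))

  Q₁≡n! : 1 ≤ n → Qcard G 1 ≡ n !
  Q₁≡n! 1≤n = ≤-antisym upper lower
    where
      open ≤-Reasoning
      PQ = perWord n (inQᵇ G 1)
      upper : Qcard G 1 ≤ n !
      upper = begin
        Qcard G 1                                  ≡⟨ countPairs-words n _ ⟩
        ∑ (allLists n n) PQ                        ≤⟨ ∑-mono (allLists n n) Q₁-upper ⟩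
        ∑ (allLists n n) (λ σ → ⟦ distinctᵇ σ ⟧)  ≡⟨ count-permutations ⟩
        n !                                        ∎
      nonempty-lower : ∀ σ → length σ ≡ n → ⟦ distinctᵇ σ ⟧ ≤ PQ σ + missing σ
      nonempty-lower []         len with subst (1 ≤_) (sym len) 1≤n
      ... | ()
      nonempty-lower (v ∷ rest) _ = Q₁-lower v rest
      lower : n ! ≤ Qcard G 1
      lower = begin
        n !                                               ≡⟨ sym count-permutations ⟩
        ∑ (allLists n n) (λ σ → ⟦ distinctᵇ σ ⟧)         ≤⟨ ∑-words-mono n n _ _ nonempty-lower ⟩
        ∑ (allLists n n) (λ σ → PQ σ + missing σ)         ≡⟨ ∑-+ (allLists n n) PQ missing ⟩
        ∑ (allLists n n) PQ + ∑ (allLists n n) missing    ≡⟨ cong (∑ (allLists n n) PQ +_) no-missing ⟩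
        ∑ (allLists n n) PQ + 0                           ≡⟨ +-identityʳ _ ⟩
        ∑ (allLists n n) PQ                               ≡⟨ sym (countPairs-words n _) ⟩
        Qcard G 1                                         ∎

S₁≡0 : ∀ {n} (G : Graph n) → Scard G 1 ≡ 0
S₁≡0 {n} G = trans (countPairs-words n _) (trans (∑-cong (allLists n n) nothing) (∑-zero (allLists n n)))
  where
    nothing : ∀ σ → perWord n (inSᵇ G 1) σ ≡ 0
    nothing σ with distinctᵇ σ
    ... | true  = ∑-zero (allFin n)
    ... | false = refl

lemma2 : (n : ℕ) (G : Graph n) → HasPerfectMatching G →
    ((t : ℕ) → 1 ≤ t → t ≤ n → n ! ≡ Qcard G t + sumS G t)
    × ((t : ℕ) → 2 ≤ t → t ≤ n → Qcard G (t ∸ 1) ≡ Qcard G t + Scard G t)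
lemma2 n G PM = cumulative , difference
  where
    open ≡-Reasoning
    difference : (t : ℕ) → 2 ≤ t → t ≤ n → Qcard G (t ∸ 1) ≡ Qcard G t + Scard G t
    difference (suc zero)    (s≤s ())    _
    difference (suc (suc k)) _           t≤n = Difference.Q-difference G k t≤n

    cumulative : (t : ℕ) → 1 ≤ t → t ≤ n → n ! ≡ Qcard G t + sumS G t
    cumulative (suc zero) _ 1≤n = begin
      n !                   ≡⟨ sym (Base.Q₁≡n! G PM 1≤n) ⟩
      Qcard G 1             ≡⟨ sym (+-identityʳ _) ⟩
      Qcard G 1 + 0         ≡⟨ cong (Qcard G 1 +_) (sym (S₁≡0 G)) ⟩
      Qcard G 1 + sumS G 1  ∎
    cumulative (suc (suc k)) _ t≤n = begin
      n !                                 ≡⟨ cumulative (suc k) (s≤s z≤n) (≤-trans (n≤1+n (suc k)) t≤n) ⟩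
      Qcard G (suc k) + sumS G (suc k)    ≡⟨ cong (_+ sumS G (suc k)) (difference (suc (suc k)) (s≤s (s≤s z≤n)) t≤n) ⟩
      Q + S + sumS G (suc k)              ≡⟨ +-assoc Q S _ ⟩
      Q + (S + sumS G (suc k))            ≡⟨ cong (Q +_) (+-comm S _) ⟩
      Q + sumS G (suc (suc k))            ∎
      where
        Q S : ℕ
        Q = Qcard G (suc (suc k))
        S = Scard G (suc (suc k))
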